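{- Let $\varphi$ be an element of the Rieger–Nishimura lattice with $\varphi\geq d_2$ or $\varphi\geq i_2$ in that lattice. Let $H$ be a Heyting algebra and $\iota:H\hookrightarrow H\oplus\top$ the lattice inclusion with $(H\oplus\top)\setminus\iota(H)=\{\top\}$. Then for every $x\in H$, if $\varphi(x)\neq\top_H$ (the top of $H$), then $\varphi(\iota(x))=\iota(\varphi(x))$.
   Context: The Rieger–Nishimura formulae in the variable $p$ are defined by $d_0=i_0=\bot$, $d_1=p$, $i_1=\neg p$ (with $\neg p=p\to\bot$), $d_{n+1}=i_n\vee d_n$, $i_{n+1}=i_n\to d_n$. The Rieger–Nishimura lattice consists of the formulae $\top$, $d_n$, $i_n$ ($n\in\mathbb{N}$), ordered by $a\le b$ iff $a\to b$ is provable in intuitionistic propositional logic. For a Heyting algebra $H$, $H\oplus\top$ is obtained by adding a new element $\top$ above all elements of $H$ (the old top of $H$ becomes an ordinary element). For a formula $\varphi(p)$ and an element $x$, $\varphi(x)$ denotes its evaluation at $p=x$. -}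

module Defs where

open import Level using (Level; Lift; lift; _⊔_)
open import Data.Nat.Base using (ℕ; zero; suc)
open import Data.List.Base using (List; []; _∷_)
open import Data.List.Membership.Propositional using (_∈_)
open import Data.Maybe.Base using (Maybe; just; nothing)
open import Data.Product.Base using (_×_; _,_)
open import Data.Unit.Polymorphic.Base using () renaming (⊤ to 𝟙; tt to ⋆)
open import Data.Empty.Polymorphic using () renaming (⊥ to 𝟘)
open import Data.Empty using (⊥-elim)
open import Relation.Nullary using (Dec; yes; no; ¬_)
open import Relation.Binary.Core using (Rel)
open import Relation.Binary.Definitions using (Decidable)
open import Relation.Binary.Lattice using (HeytingAlgebra)

infixr 6 _∧′_
infixr 5 _∨′_
infixr 4 _⇒_

data Fm : Set where
  p    : Fm
  ⊥′   : Fm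
  ⊤′   : Fm
  _∧′_ : Fm → Fm → Fm
  _∨′_ : Fm → Fm → Fm
  _⇒_  : Fm → Fm → Fm

¬′_ : Fm → Fm
¬′ a = a ⇒ ⊥′

infix 2 _⊢_

data _⊢_ (Γ : List Fm) : Fm → Set where
  hyp   : ∀ {a} → a ∈ Γ → Γ ⊢ a
  ⊤I    : Γ ⊢ ⊤′
  ⊥E    : ∀ {a} → Γ ⊢ ⊥′ → Γ ⊢ a
  ∧I    : ∀ {a b} → Γ ⊢ a → Γ ⊢ b → Γ ⊢ a ∧′ b
  ∧E₁   : ∀ {a b} → Γ ⊢ a ∧′ b → Γ ⊢ a
  ∧E₂   : ∀ {a b} → Γ ⊢ a ∧′ b → Γ ⊢ b
  ∨I₁   : ∀ {a b} → Γ ⊢ a → Γ ⊢ a ∨′ b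
  ∨I₂   : ∀ {a b} → Γ ⊢ b → Γ ⊢ a ∨′ b
  ∨E    : ∀ {a b c} → Γ ⊢ a ∨′ b → (a ∷ Γ) ⊢ c → (b ∷ Γ) ⊢ c → Γ ⊢ c
  ⇒I    : ∀ {a b} → (a ∷ Γ) ⊢ b → Γ ⊢ a ⇒ b
  ⇒E    : ∀ {a b} → Γ ⊢ a ⇒ b → Γ ⊢ a → Γ ⊢ b

IPC⊢ : Fm → Set
IPC⊢ a = [] ⊢ a

mutual
  d : ℕ → Fm
  d zero          = ⊥′
  d (suc zero)    = p
  d (suc (suc n)) = i (suc n) ∨′ d (suc n)

  i : ℕ → Fm
  i zero          = ⊥′
  i (suc zero)    = ¬′ p
  i (suc (suc n)) = i (suc n) ⇒ d (suc n)

data RN : Set where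
  top : RN
  dd  : ℕ → RN
  ii  : ℕ → RN

⌜_⌝ : RN → Fm
⌜ top ⌝  = ⊤′
⌜ dd n ⌝ = d n
⌜ ii n ⌝ = i n

infix 4 _≤RN_
_≤RN_ : RN → RN → Set
a ≤RN b = IPC⊢ (⌜ a ⌝ ⇒ ⌜ b ⌝)

module _ {c ℓ₁ ℓ₂} (H : HeytingAlgebra c ℓ₁ ℓ₂) where
  open HeytingAlgebra H

  eval : Fm → Carrier → Carrier
  eval p        x = x
  eval ⊥′       x = ⊥
  eval ⊤′       x = ⊤
  eval (a ∧′ b) x = eval a x ∧ eval b x
  eval (a ∨′ b) x = eval a x ∨ eval b x
  eval (a ⇒ b)  x = eval a x ⇨ eval b x

-- Carrier: Maybe Carrier, where
-- 'just x' is ι(x) and 'nothing' is the new top.  The order of H is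
-- assumed decidable (used to define the implication; classically
-- every Heyting algebra has this, cf. the statement which assumes LEM).

module _ {c ℓ₁ ℓ₂} (H : HeytingAlgebra c ℓ₁ ℓ₂)
         (_≤?_ : Decidable (HeytingAlgebra._≤_ H)) where
  private
    module H = HeytingAlgebra H
  open H using (Carrier)

  _≈⊕_ : Rel (Maybe Carrier) ℓ₁
  just x  ≈⊕ just y  = x H.≈ y
  nothing ≈⊕ nothing = 𝟙
  just _  ≈⊕ nothing = 𝟘
  nothing ≈⊕ just _  = 𝟘

  _≤⊕_ : Rel (Maybe Carrier) ℓ₂
  just x  ≤⊕ just y  = x H.≤ y
  _       ≤⊕ nothing = 𝟙
  nothing ≤⊕ just _  = 𝟘

  _∧⊕_ : Maybe Carrier → Maybe Carrier → Maybe Carrier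
  nothing ∧⊕ b       = b
  just x  ∧⊕ nothing = just x
  just x  ∧⊕ just y  = just (x H.∧ y)

  _∨⊕_ : Maybe Carrier → Maybe Carrier → Maybe Carrier
  nothing ∨⊕ b       = nothing
  just x  ∨⊕ nothing = nothing
  just x  ∨⊕ just y  = just (x H.∨ y)

  impDec : ∀ {x y} → Dec (x H.≤ y) → Maybe Carrier
  impDec {x} {y} (yes _) = nothing
  impDec {x} {y} (no  _) = just (x H.⇨ y)

  _⇨⊕_ : Maybe Carrier → Maybe Carrier → Maybe Carrier
  a       ⇨⊕ nothing = nothing
  nothing ⇨⊕ just y  = just y
  just x  ⇨⊕ just y  = impDec (x ≤? y)

  private
    ≈refl : ∀ {a} → a ≈⊕ a
    ≈refl {just x}  = H.Eq.refl
    ≈refl {nothing} = ⋆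

    ≈sym : ∀ {a b} → a ≈⊕ b → b ≈⊕ a
    ≈sym {just x}  {just y}  e = H.Eq.sym e
    ≈sym {nothing} {nothing} e = ⋆

    ≈trans : ∀ {a b e} → a ≈⊕ b → b ≈⊕ e → a ≈⊕ e
    ≈trans {just x}  {just y}  {just z}  u v = H.Eq.trans u v
    ≈trans {nothing} {nothing} {nothing} u v = ⋆

    ≤refl : ∀ {a b} → a ≈⊕ b → a ≤⊕ b
    ≤refl {just x}  {just y}  e = H.reflexive e
    ≤refl {nothing} {nothing} e = ⋆
    ≤refl {just x}  {nothing} e = ⋆

    ≤top : ∀ a → a ≤⊕ nothing
    ≤top (just x) = ⋆
    ≤top nothing  = ⋆

    ≤trans : ∀ {a b e} → a ≤⊕ b → b ≤⊕ e → a ≤⊕ e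
    ≤trans {just x}  {just y}  {just z}  u v = H.trans u v
    ≤trans {a}       {_}       {nothing} u v = ≤top a
    ≤trans {nothing} {nothing} {just z}  u ()
    ≤trans {just x}  {nothing} {just z}  u ()

    ≤antisym : ∀ {a b} → a ≤⊕ b → b ≤⊕ a → a ≈⊕ b
    ≤antisym {just x}  {just y}  u v = H.antisym u v
    ≤antisym {nothing} {nothing} u v = ⋆

    sup : ∀ a b → a ≤⊕ (a ∨⊕ b) × b ≤⊕ (a ∨⊕ b)
                 × (∀ e → a ≤⊕ e → b ≤⊕ e → (a ∨⊕ b) ≤⊕ e)
    sup nothing  b        = ⋆ , ≤top b , λ { nothing _ _ → ⋆ }
    sup (just x) nothing  = ⋆ , ⋆ , λ { nothing _ _ → ⋆ }
    sup (just x) (just y) = H.x≤x∨y x y , H.y≤x∨y x y ,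
      λ { nothing _ _ → ⋆ ; (just z) u v → H.∨-least u v }

    inf : ∀ a b → (a ∧⊕ b) ≤⊕ a × (a ∧⊕ b) ≤⊕ b
                 × (∀ e → e ≤⊕ a → e ≤⊕ b → e ≤⊕ (a ∧⊕ b))
    inf nothing  b        = ≤top b , ≤refl {b} {b} (≈refl {b}) , λ _ _ v → v
    inf (just x) nothing  = H.refl , ⋆ , λ _ u _ → u
    inf (just x) (just y) = H.x∧y≤x x y , H.x∧y≤y x y ,
      λ { (just z) u v → H.∧-greatest u v }

    minimum : ∀ a → just H.⊥ ≤⊕ a
    minimum (just x) = H.minimum x
    minimum nothing  = ⋆

    expo : ∀ w a b → ((w ∧⊕ a) ≤⊕ b → w ≤⊕ (a ⇨⊕ b))
                   × (w ≤⊕ (a ⇨⊕ b) → (w ∧⊕ a) ≤⊕ b)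
    expo w        a        nothing  = (λ _ → ≤top w) , (λ _ → ≤top (w ∧⊕ a))
    expo nothing  nothing  (just y) = (λ u → u) , (λ u → u)
    expo (just z) nothing  (just y) = (λ u → u) , (λ u → u)
    expo nothing  (just x) (just y) with x ≤? y
    ... | yes x≤y = (λ _ → ⋆) , (λ _ → x≤y)
    ... | no  x≰y = (λ u → ⊥-elim (x≰y u)) , (λ ())
    expo (just z) (just x) (just y) with x ≤? y
    ... | yes x≤y = (λ _ → ⋆) , (λ _ → H.trans (H.x∧y≤y z x) x≤y)
    ... | no  x≰y = H.transpose-⇨ , H.transpose-∧

  H⊕⊤ : HeytingAlgebra c ℓ₁ ℓ₂
  H⊕⊤ = record
    { Carrier = Maybe Carrier
    ; _≈_ = _≈⊕_
    ; _≤_ = _≤⊕_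
    ; _∨_ = _∨⊕_
    ; _∧_ = _∧⊕_
    ; _⇨_ = _⇨⊕_
    ; ⊤ = nothing
    ; ⊥ = just H.⊥
    ; isHeytingAlgebra = record
      { isBoundedLattice = record
        { isLattice = record
          { isPartialOrder = record
            { isPreorder = record
              { isEquivalence = record { refl = λ {a} → ≈refl {a} ; sym = λ {a} {b} → ≈sym {a} {b} ; trans = λ {a} {b} {e} → ≈trans {a} {b} {e} }
              ; reflexive = λ {a} {b} → ≤refl {a} {b}
              ; trans = λ {a} {b} {e} → ≤trans {a} {b} {e}
              }
            ; antisym = λ {a} {b} → ≤antisym {a} {b}
            }
          ; supremum = sup
          ; infimum = inf
          }
        ; maximum = ≤top
        ; minimum = minimum
        }
      ; exponential = expo
      }
    }

  ι : Carrier → Maybe Carrier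
  ι = just

-- Collapsing the new top of H ⊕ ⊤ onto the old top of H is a Heyting
-- algebra homomorphism H ⊕ ⊤ → H that is a left inverse of ι.  Hence it
-- sends φ(ι x) to φ(x) for every formula φ, and when φ(x) is not the top
-- of H, the only element of H ⊕ ⊤ it sends to φ(x) is ι(φ(x)).  The
-- argument works for every formula.
module Submission where

open import Defs
open import Data.Sum.Base using (_⊎_)
open import Relation.Nullary using (¬_; yes; no)
open import Relation.Binary.Lattice using (HeytingAlgebra)
open import Axiom.ExcludedMiddle using (ExcludedMiddle)
open import Data.Maybe.Base using (Maybe; just; nothing)
open import Data.Empty using (⊥-elim)
open import Relation.Binary.Definitions using (Decidable)
import Relation.Binary.Lattice.Properties.HeytingAlgebra as HeytingAlgebraProperties
import Relation.Binary.Lattice.Properties.MeetSemilattice as MeetSemilatticeProperties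
import Relation.Binary.Lattice.Properties.JoinSemilattice as JoinSemilatticeProperties
import Relation.Binary.Lattice.Properties.BoundedMeetSemilattice as BoundedMeetSemilatticeProperties
import Relation.Binary.Lattice.Properties.BoundedLattice as BoundedLatticeProperties

module ⇨-Properties {c ℓ₁ ℓ₂} (H : HeytingAlgebra c ℓ₁ ℓ₂) where
  open HeytingAlgebra H
  open HeytingAlgebraProperties H using (y≤x⇨y; ⇨-eval; ⇨-unit; ⇨ʳ-covariant)
  open BoundedMeetSemilatticeProperties boundedMeetSemilattice using (identityʳ)

  ⇨-zeroʳ : ∀ x → (x ⇨ ⊤) ≈ ⊤
  ⇨-zeroʳ x = antisym (maximum _) y≤x⇨y

  ⇨-identityˡ : ∀ x → (⊤ ⇨ x) ≈ x
  ⇨-identityˡ x = antisym (trans (reflexive (Eq.sym (identityʳ (⊤ ⇨ x)))) ⇨-eval) y≤x⇨y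

  x≤y⇒x⇨y≈⊤ : ∀ {x y} → x ≤ y → (x ⇨ y) ≈ ⊤
  x≤y⇒x⇨y≈⊤ x≤y = antisym (maximum _) (trans (reflexive (Eq.sym ⇨-unit)) (⇨ʳ-covariant x≤y))

module Collapse {c ℓ₁ ℓ₂} (H : HeytingAlgebra c ℓ₁ ℓ₂)
                (_≤?_ : Decidable (HeytingAlgebra._≤_ H)) where
  open HeytingAlgebra H
  open HeytingAlgebraProperties H using (⇨-cong)
  open MeetSemilatticeProperties meetSemilattice using (∧-cong)
  open JoinSemilatticeProperties joinSemilattice using (∨-cong)
  open BoundedMeetSemilatticeProperties boundedMeetSemilattice using (identityˡ; identityʳ)
  open BoundedLatticeProperties boundedLattice using (∨-zeroˡ; ∨-zeroʳ)
  open ⇨-Properties H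

  H⊕ : HeytingAlgebra c ℓ₁ ℓ₂
  H⊕ = H⊕⊤ H _≤?_

  open HeytingAlgebra H⊕ using ()
    renaming (_≈_ to _≈⁺_; _∧_ to _∧⁺_; _∨_ to _∨⁺_; _⇨_ to _⇨⁺_)

  eval⁺ : Fm → Carrier → Maybe Carrier
  eval⁺ φ x = eval H⊕ φ (ι H _≤?_ x)

  collapse : Maybe Carrier → Carrier
  collapse (just x) = x
  collapse nothing  = ⊤

  collapse-∧ : ∀ a b → collapse (a ∧⁺ b) ≈ collapse a ∧ collapse b
  collapse-∧ nothing  b        = Eq.sym (identityˡ (collapse b))
  collapse-∧ (just x) nothing  = Eq.sym (identityʳ x)
  collapse-∧ (just x) (just y) = Eq.refl

  collapse-∨ : ∀ a b → collapse (a ∨⁺ b) ≈ collapse a ∨ collapse b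
  collapse-∨ nothing  b        = Eq.sym (∨-zeroˡ (collapse b))
  collapse-∨ (just x) nothing  = Eq.sym (∨-zeroʳ x)
  collapse-∨ (just x) (just y) = Eq.refl

  collapse-⇨ : ∀ a b → collapse (a ⇨⁺ b) ≈ (collapse a ⇨ collapse b)
  collapse-⇨ a        nothing  = Eq.sym (⇨-zeroʳ (collapse a))
  collapse-⇨ nothing  (just y) = Eq.sym (⇨-identityˡ y)
  collapse-⇨ (just x) (just y) with x ≤? y
  ... | yes x≤y = Eq.sym (x≤y⇒x⇨y≈⊤ x≤y)
  ... | no  _   = Eq.refl

  collapse-eval-ι : ∀ φ x → collapse (eval⁺ φ x) ≈ eval H φ x
  collapse-eval-ι p        x = Eq.refl
  collapse-eval-ι ⊥′       x = Eq.refl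
  collapse-eval-ι ⊤′       x = Eq.refl
  collapse-eval-ι (φ ∧′ ψ) x =
    Eq.trans (collapse-∧ (eval⁺ φ x) (eval⁺ ψ x))
             (∧-cong (collapse-eval-ι φ x) (collapse-eval-ι ψ x))
  collapse-eval-ι (φ ∨′ ψ) x =
    Eq.trans (collapse-∨ (eval⁺ φ x) (eval⁺ ψ x))
             (∨-cong (collapse-eval-ι φ x) (collapse-eval-ι ψ x))
  collapse-eval-ι (φ ⇒ ψ)  x =
    Eq.trans (collapse-⇨ (eval⁺ φ x) (eval⁺ ψ x))
             (⇨-cong (collapse-eval-ι φ x) (collapse-eval-ι ψ x))

  collapse≈⇒≈ι : ∀ a {h} → ¬ h ≈ ⊤ → collapse a ≈ h → a ≈⁺ ι H _≤?_ h
  collapse≈⇒≈ι (just x) h≉⊤ x≈h = x≈h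
  collapse≈⇒≈ι nothing  h≉⊤ ⊤≈h = ⊥-elim (h≉⊤ (Eq.sym ⊤≈h))

lemma2p18 : ∀ {c ℓ₁ ℓ₂} → (em : ExcludedMiddle ℓ₂) →
    (φ : RN) → (dd 2 ≤RN φ) ⊎ (ii 2 ≤RN φ) →
    (H : HeytingAlgebra c ℓ₁ ℓ₂) → (x : HeytingAlgebra.Carrier H) →
    ¬ (HeytingAlgebra._≈_ H (eval H ⌜ φ ⌝ x) (HeytingAlgebra.⊤ H)) →
    HeytingAlgebra._≈_ (H⊕⊤ H (λ _ _ → em))
      (eval (H⊕⊤ H (λ _ _ → em)) ⌜ φ ⌝ (ι H (λ _ _ → em) x))
      (ι H (λ _ _ → em) (eval H ⌜ φ ⌝ x))
lemma2p18 em φ _ H x φx≉⊤ = collapse≈⇒≈ι (eval⁺ ⌜ φ ⌝ x) φx≉⊤ (collapse-eval-ι ⌜ φ ⌝ x)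
  where open Collapse H (λ _ _ → em)
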